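{- For every positive integer $n$ that is a multiple of $4$, \[ \mathrm{ex}(n,K_3,K_{1,2,2})\ge \frac{n^2}{4}. \]
   Context: For graphs $T$ and $H$ (with no isolated vertices) and a positive integer $n$, the generalized Turán number $\mathrm{ex}(n,T,H)$ is the maximum number of copies of $T$ (subgraphs isomorphic to $T$, not necessarily induced) in an $n$-vertex graph that contains no subgraph isomorphic to $H$. $K_{1,2,2}$ is the complete tripartite graph with parts of sizes $1,2,2$ and $K_3$ is the triangle. -}

module Defs where

open import Data.Bool using (Bool; true; false; _∧_; not; T)
open import Data.Bool.Properties using (T?)
open import Data.Empty using (⊥-elim)
open import Data.Nat using (ℕ; zero; suc; _≤_)
open import Data.Fin using (Fin; zero; suc; _<?_)
open import Data.Fin.Properties using (_≟_)
open import Data.List using (List; length; filter; allFin; concatMap; map; _∷_; [])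
open import Data.Product using (Σ; ∃; _×_; _,_; proj₁)
open import Function.Definitions using (Injective)
open import Relation.Binary.PropositionalEquality using (_≡_; refl; sym; cong)
open import Relation.Nullary using (¬_; yes; no)
open import Relation.Nullary.Decidable using (⌊_⌋)

record Graph (n : ℕ) : Set where
  field
    adj   : Fin n → Fin n → Bool
    adj-sym   : ∀ i j → adj i j ≡ adj j i
    adj-irref : ∀ i → adj i i ≡ false
open Graph public

Contains : ∀ {n k} → Graph n → Graph k → Set
Contains {n} {k} G H =
  Σ (Fin k → Fin n) λ f → Injective _≡_ _≡_ f ×
    (∀ i j → adj H i j ≡ true → adj G (f i) (f j) ≡ true)

Free : ∀ {n k} → Graph k → Graph n → Set
Free H G = ¬ Contains G H

-- Number of copies of K₃ in G: a copy of the triangle is determined by its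
-- vertex set, so this is the number of triples a < b < c that are pairwise
-- adjacent.
triples : (n : ℕ) → List (Fin n × Fin n × Fin n)
triples n =
  concatMap (λ a → concatMap (λ b → map (λ c → (a , b , c)) (allFin n)) (allFin n)) (allFin n)

isTriangle : ∀ {n} → Graph n → Fin n × Fin n × Fin n → Bool
isTriangle G (a , b , c) =
  ⌊ a <? b ⌋ ∧ ⌊ b <? c ⌋ ∧ adj G a b ∧ adj G b c ∧ adj G a c

triangleCount : ∀ {n} → Graph n → ℕ
triangleCount {n} G = length (filter (λ t → T? (isTriangle G t)) (triples n))

part : Fin 5 → Fin 3
part zero = zero
part (suc zero) = suc zero
part (suc (suc zero)) = suc zero
part (suc (suc (suc zero))) = suc (suc zero)
part (suc (suc (suc (suc zero)))) = suc (suc zero)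

K122 : Graph 5
K122 = record
  { adj   = λ i j → not ⌊ part i ≟ part j ⌋
  ; adj-sym   = λ i j → cong not (symDec (part i) (part j))
  ; adj-irref = λ i → cong not (reflDec (part i))
  }
  where
  symDec : ∀ (x y : Fin 3) → ⌊ x ≟ y ⌋ ≡ ⌊ y ≟ x ⌋
  symDec x y with x ≟ y | y ≟ x
  ... | yes _ | yes _ = refl
  ... | no _  | no _  = refl
  ... | yes p | no q  = ⊥-elim (q (sym p))
  ... | no p  | yes q = ⊥-elim (p (sym q))
  reflDec : ∀ (x : Fin 3) → ⌊ x ≟ x ⌋ ≡ true
  reflDec x with x ≟ x
  ... | yes _ = refl
  ... | no p  = ⊥-elim (p refl)

-- ex(n, K₃, H) ≥ k : since ex is the maximum over the finite nonempty set of
-- n-vertex H-free graphs, this holds iff some H-free graph on n vertices has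
-- at least k copies of K₃.
ExK3AtLeast : ∀ {h} → (n : ℕ) → Graph h → ℕ → Set
ExK3AtLeast n H k = Σ (Graph n) λ G → Free H G × k ≤ triangleCount G

-- Write n = 4m.  The extremal graph is K_{2m,2m} together with a perfect
-- matching inside each of its two sides: on the vertices 0 … 4m-1, the
-- sides are [0, 2m) and [2m, 4m), and x is matched with x + m.
--
--  * K_{1,2,2}-freeness is a general fact: if the vertices of a graph can be
--    2-coloured so that every vertex has at most one neighbour of its own
--    colour, then the graph has no K_{1,2,2}.  (The hub of a K_{1,2,2} shares
--    its colour with at most one of the other four vertices, so three of
--    those share a colour, and one of the three is adjacent to the other two.)
--    The sides of our graph give such a colouring.
--  * Triangle count: each of the m matching edges in the first side forms a
--    triangle with each of the 2m vertices of the second side, and each of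
--    the m matching edges of the second side with each of the 2m vertices of
--    the first side: 4m² = n²/4 triangles.
module Submission where

open import Defs
open import Data.Nat using (ℕ; zero; suc; _+_; _*_; _/_; _≤_; _<_; z≤n; s≤s)
open import Data.Nat.Properties
  using (_≟_; _<?_; ≤-trans; ≤-reflexive; <-≤-trans; <⇒≢; <⇒≱;
         +-assoc; +-mono-≤; +-monoˡ-<; +-monoʳ-<; +-cancelʳ-≡; +-cancelʳ-<; *-identityʳ;
         m≤m+n; m≤n+m; m<m+n; module ≤-Reasoning)
open import Data.Nat.Divisibility using (_∣_; divides)
open import Data.Nat.DivMod using (m*n/n≡m)
open import Data.Nat.ListAction using (sum)
open import Data.Nat.ListAction.Properties using (sum-++)
open import Data.Nat.Tactic.RingSolver using (solve-∀)
open import Data.Bool using (Bool; true; false; _∧_; _∨_; _xor_)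
open import Data.Bool.Properties using (T?; ¬-not; xor-same; xor-comm; ∨-comm; ∨-zeroʳ)
  renaming (_≟_ to _≟ᵇ_)
open import Data.Fin using (Fin; toℕ) renaming (zero to fzero; suc to fsuc)
open import Data.Fin.Properties using (toℕ<n; toℕ-injective)
open import Data.List using (List; []; _∷_; _++_; length; filter; map; concatMap; allFin; tabulate)
open import Data.List.Properties using (map-∘; map-cong; map-++; map-tabulate)
open import Data.Product using (_×_; _,_)
open import Data.Sum using (_⊎_; inj₁; inj₂)
open import Data.Empty using (⊥; ⊥-elim)
open import Relation.Nullary using (Dec; yes; no; ¬_; contradiction)
open import Relation.Nullary.Decidable using (⌊_⌋; isYes≗does; dec-true; dec-false)
open import Relation.Binary.PropositionalEquality

⌊⌋-true : ∀ {A : Set} (a? : Dec A) → A → ⌊ a? ⌋ ≡ true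
⌊⌋-true a? a = trans (isYes≗does a?) (dec-true a? a)

⌊⌋-false : ∀ {A : Set} (a? : Dec A) → ¬ A → ⌊ a? ⌋ ≡ false
⌊⌋-false a? ¬a = trans (isYes≗does a?) (dec-false a? ¬a)

∑ : ℕ → (ℕ → ℕ) → ℕ
∑ zero    f = 0
∑ (suc n) f = f 0 + ∑ n (λ k → f (suc k))

syntax ∑ n (λ k → e) = ∑[ k < n ] e

∑-split : ∀ x y (f : ℕ → ℕ) → ∑ (x + y) f ≡ ∑ x f + ∑[ k < y ] f (x + k)
∑-split zero    y f = refl
∑-split (suc x) y f =
  trans (cong (f 0 +_) (∑-split x y (λ k → f (suc k)))) (sym (+-assoc (f 0) _ _))

∑-prefix : ∀ x y (f : ℕ → ℕ) → ∑ x f ≤ ∑ (x + y) f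
∑-prefix x y f = ≤-trans (m≤m+n _ _) (≤-reflexive (sym (∑-split x y f)))

∑-term : ∀ {n k} (f : ℕ → ℕ) → k < n → f k ≤ ∑ n f
∑-term {suc n} {zero}  f _         = m≤m+n _ _
∑-term {suc n} {suc k} f (s≤s k<n) = ≤-trans (∑-term (λ j → f (suc j)) k<n) (m≤n+m _ _)

∑-lower : ∀ n c (f : ℕ → ℕ) → (∀ k → k < n → c ≤ f k) → n * c ≤ ∑ n f
∑-lower zero    c f c≤f = z≤n
∑-lower (suc n) c f c≤f =
  +-mono-≤ (c≤f 0 (s≤s z≤n))
           (∑-lower n c (λ k → f (suc k)) (λ k k<n → c≤f (suc k) (s≤s k<n)))

indicator : Bool → ℕ
indicator true  = 1
indicator false = 0

length-filter : ∀ {A : Set} (q : A → Bool) (xs : List A) →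
                length (filter (λ x → T? (q x)) xs) ≡ sum (map (λ x → indicator (q x)) xs)
length-filter q []       = refl
length-filter q (x ∷ xs) with q x
... | true  = cong suc (length-filter q xs)
... | false = length-filter q xs

sum-concatMap : ∀ {A B : Set} (h : B → ℕ) (F : A → List B) (xs : List A) →
                sum (map h (concatMap F xs)) ≡ sum (map (λ x → sum (map h (F x))) xs)
sum-concatMap h F []       = refl
sum-concatMap h F (x ∷ xs) = begin
  sum (map h (F x ++ concatMap F xs))
    ≡⟨ cong sum (map-++ h (F x) _) ⟩
  sum (map h (F x) ++ map h (concatMap F xs))
    ≡⟨ sum-++ (map h (F x)) _ ⟩
  sum (map h (F x)) + sum (map h (concatMap F xs))
    ≡⟨ cong (sum (map h (F x)) +_) (sum-concatMap h F xs) ⟩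
  sum (map h (F x)) + sum (map (λ y → sum (map h (F y))) xs) ∎
  where open ≡-Reasoning

sum-allFin : ∀ n (F : ℕ → ℕ) → sum (map (λ i → F (toℕ i)) (allFin n)) ≡ ∑ n F
sum-allFin n F =
  trans (cong sum (map-tabulate {n = n} (λ i → i) (λ i → F (toℕ i)))) (sum-tabulate n F)
  where
  sum-tabulate : ∀ n (F : ℕ → ℕ) → sum (tabulate {n = n} (λ i → F (toℕ i))) ≡ ∑ n F
  sum-tabulate zero    F = refl
  sum-tabulate (suc n) F = cong (F 0 +_) (sum-tabulate n (λ k → F (suc k)))

onℕ : ∀ {n} → (ℕ → ℕ → ℕ → ℕ) → Fin n × Fin n × Fin n → ℕ
onℕ h (a , b , c) = h (toℕ a) (toℕ b) (toℕ c)

sum-triples : ∀ n (h : ℕ → ℕ → ℕ → ℕ) →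
              sum (map (onℕ h) (triples n)) ≡ ∑[ a < n ] ∑[ b < n ] ∑[ c < n ] h a b c
sum-triples n h = begin
  sum (map (onℕ h) (concatMap row (allFin n)))
    ≡⟨ sum-concatMap (onℕ h) row (allFin n) ⟩
  sum (map (λ a → sum (map (onℕ h) (row a))) (allFin n))
    ≡⟨ cong sum (map-cong row-sum (allFin n)) ⟩
  sum (map (λ a → ∑[ b < n ] ∑[ c < n ] h (toℕ a) b c) (allFin n))
    ≡⟨ sum-allFin n _ ⟩
  ∑[ a < n ] ∑[ b < n ] ∑[ c < n ] h a b c ∎
  where
  open ≡-Reasoning
  entry : Fin n → Fin n → List (Fin n × Fin n × Fin n)
  entry a b = map (λ c → (a , b , c)) (allFin n)
  row : Fin n → List (Fin n × Fin n × Fin n)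
  row a = concatMap (entry a) (allFin n)
  entry-sum : ∀ a b → sum (map (onℕ h) (entry a b)) ≡ ∑[ c < n ] h (toℕ a) (toℕ b) c
  entry-sum a b = trans (cong sum (sym (map-∘ (allFin n)))) (sum-allFin n _)
  row-sum : ∀ a → sum (map (onℕ h) (row a)) ≡ ∑[ b < n ] ∑[ c < n ] h (toℕ a) b c
  row-sum a = begin
    sum (map (onℕ h) (row a))
      ≡⟨ sum-concatMap (onℕ h) (entry a) (allFin n) ⟩
    sum (map (λ b → sum (map (onℕ h) (entry a b))) (allFin n))
      ≡⟨ cong sum (map-cong (entry-sum a) (allFin n)) ⟩
    sum (map (λ b → ∑[ c < n ] h (toℕ a) (toℕ b) c) (allFin n))
      ≡⟨ sum-allFin n _ ⟩
    ∑[ b < n ] ∑[ c < n ] h (toℕ a) b c ∎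

inducedGraph : (n : ℕ) (e : ℕ → ℕ → Bool) →
               (∀ x y → e x y ≡ e y x) → (∀ x → e x x ≡ false) → Graph n
inducedGraph n e e-sym e-irrefl = record
  { adj       = λ i j → e (toℕ i) (toℕ j)
  ; adj-sym   = λ i j → e-sym (toℕ i) (toℕ j)
  ; adj-irref = λ i → e-irrefl (toℕ i)
  }

isTriangleℕ : (ℕ → ℕ → Bool) → ℕ → ℕ → ℕ → Bool
isTriangleℕ e a b c = ⌊ a <? b ⌋ ∧ ⌊ b <? c ⌋ ∧ e a b ∧ e b c ∧ e a c

triangleCount-induced :
  ∀ n e e-sym e-irrefl →
  triangleCount (inducedGraph n e e-sym e-irrefl)
    ≡ ∑[ a < n ] ∑[ b < n ] ∑[ c < n ] indicator (isTriangleℕ e a b c)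
triangleCount-induced n e e-sym e-irrefl =
  trans (length-filter (isTriangle (inducedGraph n e e-sym e-irrefl)) (triples n))
        (sum-triples n (λ a b c → indicator (isTriangleℕ e a b c)))

MonochromaticMatching : ∀ {n} → Graph n → (Fin n → Bool) → Set
MonochromaticMatching G colour =
  ∀ {x y z} → adj G x y ≡ true → adj G x z ≡ true →
  colour y ≡ colour x → colour z ≡ colour x → y ≡ z

≢-both : ∀ {a b c : Bool} → a ≢ c → b ≢ c → a ≡ b
≢-both a≢c b≢c = trans (¬-not a≢c) (sym (¬-not b≢c))

k₀ k₁ k₂ k₃ k₄ : Fin 5
k₀ = fzero
k₁ = fsuc fzero
k₂ = fsuc (fsuc fzero)
k₃ = fsuc (fsuc (fsuc fzero))
k₄ = fsuc (fsuc (fsuc (fsuc fzero)))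

-- The hub shares its colour with at most one of k₁ … k₄; so three of them
-- avoid it, hence share one colour, and one of these three is adjacent to
-- the two others.  Either way some vertex has two neighbours of its colour.
monochromaticMatching⇒K122-free : ∀ {n} (G : Graph n) (colour : Fin n → Bool) →
                                  MonochromaticMatching G colour → Free K122 G
monochromaticMatching⇒K122-free G colour matching (f , f-inj , f-hom) =
  cases (shares k₁) (shares k₂) (shares k₃) (shares k₄)
  where
  shares : ∀ x → Dec (colour (f x) ≡ colour (f k₀))
  shares x = colour (f x) ≟ᵇ colour (f k₀)

  crowded : ∀ x y z → adj K122 x y ≡ true → adj K122 x z ≡ true → y ≢ z →
            colour (f y) ≡ colour (f x) → colour (f z) ≡ colour (f x) → ⊥
  crowded x y z xy xz y≢z fy fz = y≢z (f-inj (matching (f-hom x y xy) (f-hom x z xz) fy fz))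

  cases : Dec (colour (f k₁) ≡ colour (f k₀)) → Dec (colour (f k₂) ≡ colour (f k₀)) →
          Dec (colour (f k₃) ≡ colour (f k₀)) → Dec (colour (f k₄) ≡ colour (f k₀)) → ⊥
  cases (yes p) (yes q) _       _       = crowded k₀ k₁ k₂ refl refl (λ ()) p q
  cases (yes p) (no q)  (yes r) _       = crowded k₀ k₁ k₃ refl refl (λ ()) p r
  cases (yes p) (no q)  (no r)  (yes s) = crowded k₀ k₁ k₄ refl refl (λ ()) p s
  cases (yes p) (no q)  (no r)  (no s)  = crowded k₂ k₃ k₄ refl refl (λ ()) (≢-both r q) (≢-both s q)
  cases (no p)  (yes q) (yes r) _       = crowded k₀ k₂ k₃ refl refl (λ ()) q r
  cases (no p)  (yes q) (no r)  (yes s) = crowded k₀ k₂ k₄ refl refl (λ ()) q s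
  cases (no p)  (yes q) (no r)  (no s)  = crowded k₁ k₃ k₄ refl refl (λ ()) (≢-both r p) (≢-both s p)
  cases (no p)  (no q)  (yes r) (yes s) = crowded k₀ k₃ k₄ refl refl (λ ()) r s
  cases (no p)  (no q)  (yes r) (no s)  = crowded k₄ k₁ k₂ refl refl (λ ()) (≢-both p s) (≢-both q s)
  cases (no p)  (no q)  (no r)  _       = crowded k₃ k₁ k₂ refl refl (λ ()) (≢-both p r) (≢-both q r)

module Construction (m : ℕ) (m>0 : 0 < m) where

  half n : ℕ
  half = m + m
  n    = m * 4

  n≡half+half : n ≡ half + half
  n≡half+half = identity m
    where
    identity : ∀ m → m * 4 ≡ (m + m) + (m + m)
    identity = solve-∀

  side : ℕ → Bool
  side x = ⌊ x <? half ⌋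

  first-side : ∀ {x} → x < half → side x ≡ true
  first-side {x} x<half = ⌊⌋-true (x <? half) x<half

  second-side : ∀ {x} → half ≤ x → side x ≡ false
  second-side {x} half≤x = ⌊⌋-false (x <? half) (λ x<half → <⇒≱ x<half half≤x)

  matched : ℕ → ℕ → Bool
  matched x y = ⌊ x + m ≟ y ⌋ ∨ ⌊ y + m ≟ x ⌋

  edge : ℕ → ℕ → Bool
  edge x y = (side x xor side y) ∨ matched x y

  edge-sym : ∀ x y → edge x y ≡ edge y x
  edge-sym x y = cong₂ _∨_ (xor-comm (side x) (side y)) (∨-comm ⌊ x + m ≟ y ⌋ _)

  not-self-matched : ∀ x → x + m ≢ x
  not-self-matched x x+m≡x = <⇒≢ (m<m+n x m>0) (sym x+m≡x)

  edge-irrefl : ∀ x → edge x x ≡ false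
  edge-irrefl x rewrite xor-same (side x) | ⌊⌋-false (x + m ≟ x) (not-self-matched x) = refl

  G : Graph n
  G = inducedGraph n edge edge-sym edge-irrefl

  same-side-matched : ∀ {x y} → side y ≡ side x → edge x y ≡ true → x + m ≡ y ⊎ y + m ≡ x
  same-side-matched {x} {y} same xy with x + m ≟ y | y + m ≟ x
  ... | yes x+m≡y | _         = inj₁ x+m≡y
  ... | no _      | yes y+m≡x = inj₂ y+m≡x
  ... | no _      | no _      = contradiction (trans (sym (cong (_∨ false) no-cross)) xy) λ ()
    where
    no-cross : side x xor side y ≡ false
    no-cross = trans (cong (side x xor_) same) (xor-same (side x))

  translate-other-side : ∀ {y z} → y ≡ z + half → y < n → side y ≢ side z
  translate-other-side {y} {z} refl y<n same =
    contradiction (trans (sym y-second) (trans same z-first)) λ ()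
    where
    y-second : side y ≡ false
    y-second = second-side (m≤n+m half z)
    z-first : side z ≡ true
    z-first = first-side (+-cancelʳ-< half z half (subst (z + half <_) n≡half+half y<n))

  -- So two neighbours of x on its side coincide: both are x's partner.
  same-side-unique : ∀ {x y z} → y < n → z < n → edge x y ≡ true → edge x z ≡ true →
                     side y ≡ side x → side z ≡ side x → y ≡ z
  same-side-unique {x} {y} {z} y<n z<n xy xz sy sz
    with same-side-matched sy xy | same-side-matched sz xz
  ... | inj₁ x+m≡y | inj₁ x+m≡z = trans (sym x+m≡y) x+m≡z
  ... | inj₂ y+m≡x | inj₂ z+m≡x = +-cancelʳ-≡ m y z (trans y+m≡x (sym z+m≡x))
  ... | inj₁ x+m≡y | inj₂ z+m≡x =
    ⊥-elim (translate-other-side y≡z+half y<n (trans sy (sym sz)))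
    where
    y≡z+half : y ≡ z + half
    y≡z+half = trans (sym x+m≡y) (trans (cong (_+ m) (sym z+m≡x)) (+-assoc z m m))
  ... | inj₂ y+m≡x | inj₁ x+m≡z =
    ⊥-elim (translate-other-side z≡y+half z<n (trans sz (sym sy)))
    where
    z≡y+half : z ≡ y + half
    z≡y+half = trans (sym x+m≡z) (trans (cong (_+ m) (sym y+m≡x)) (+-assoc y m m))

  G-K122-free : Free K122 G
  G-K122-free = monochromaticMatching⇒K122-free G (λ i → side (toℕ i)) matching
    where
    matching : MonochromaticMatching G (λ i → side (toℕ i))
    matching {x} {y} {z} xy xz sy sz =
      toℕ-injective (same-side-unique (toℕ<n y) (toℕ<n z) xy xz sy sz)

  cross-edge : ∀ {a b} → a < half → half ≤ b → edge a b ≡ true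
  cross-edge a<half half≤b rewrite first-side a<half | second-side half≤b = refl

  matching-edge : ∀ x → edge x (x + m) ≡ true
  matching-edge x rewrite ⌊⌋-true (x + m ≟ x + m) refl = ∨-zeroʳ _

  triangle : ℕ → ℕ → ℕ → ℕ
  triangle a b c = indicator (isTriangleℕ edge a b c)

  is-triangle : ∀ {a b c} → a < b → b < c →
                edge a b ≡ true → edge b c ≡ true → edge a c ≡ true → triangle a b c ≡ 1
  is-triangle {a} {b} {c} a<b b<c ab bc ac
    rewrite ⌊⌋-true (a <? b) a<b | ⌊⌋-true (b <? c) b<c | ab | bc | ac = refl

  first-side-triangle : ∀ {x j} → x < m → triangle x (x + m) (half + j) ≡ 1
  first-side-triangle {x} {j} x<m =
    is-triangle (m<m+n x m>0) (<-≤-trans x+m<half half≤half+j)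
                (matching-edge x) (cross-edge x+m<half half≤half+j)
                (cross-edge (<-≤-trans x<m (m≤m+n m m)) half≤half+j)
    where
    x+m<half : x + m < half
    x+m<half = +-monoˡ-< m x<m
    half≤half+j : half ≤ half + j
    half≤half+j = m≤m+n half j

  second-side-triangle : ∀ {a i} → a < half → triangle a (half + i) (half + i + m) ≡ 1
  second-side-triangle {a} {i} a<half =
    is-triangle (<-≤-trans a<half half≤half+i) (m<m+n (half + i) m>0)
                (cross-edge a<half half≤half+i) (matching-edge (half + i))
                (cross-edge a<half (≤-trans half≤half+i (m≤m+n (half + i) m)))
    where
    half≤half+i : half ≤ half + i
    half≤half+i = m≤m+n half i

  last-quarter : ∀ {i} → i < m → half + i + m < n
  last-quarter {i} i<m = subst₂ _<_ (sym (+-assoc half i m)) (sym n≡half+half)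
                                (+-monoʳ-< half (+-monoˡ-< m i<m))

  ∑-halves : ∀ (f : ℕ → ℕ) → ∑ n f ≡ ∑ half f + ∑[ k < half ] f (half + k)
  ∑-halves f = trans (cong (λ N → ∑ N f) n≡half+half) (∑-split half half f)

  -- Number of triangles whose least vertex is a.
  τ : ℕ → ℕ
  τ a = ∑[ b < n ] ∑[ c < n ] triangle a b c

  second-side-count : ∀ {a} → a < half → m ≤ ∑[ i < half ] ∑[ c < n ] triangle a (half + i) c
  second-side-count {a} a<half = begin
    m
      ≡⟨ sym (*-identityʳ m) ⟩
    m * 1
      ≤⟨ ∑-lower m 1 _ one-each ⟩
    ∑[ i < m ] ∑[ c < n ] triangle a (half + i) c
      ≤⟨ ∑-prefix m m _ ⟩
    ∑[ i < half ] ∑[ c < n ] triangle a (half + i) c ∎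
    where
    open ≤-Reasoning
    one-each : ∀ i → i < m → 1 ≤ ∑[ c < n ] triangle a (half + i) c
    one-each i i<m = ≤-trans (≤-reflexive (sym (second-side-triangle a<half)))
                             (∑-term (triangle a (half + i)) (last-quarter i<m))

  first-side-count : ∀ {x} → x < m → half ≤ ∑[ c < n ] triangle x (x + m) c
  first-side-count {x} x<m = begin
    half
      ≡⟨ sym (*-identityʳ half) ⟩
    half * 1
      ≤⟨ ∑-lower half 1 _ (λ j _ → ≤-reflexive (sym (first-side-triangle x<m))) ⟩
    ∑[ j < half ] triangle x (x + m) (half + j)
      ≤⟨ m≤n+m _ _ ⟩
    ∑ half (triangle x (x + m)) + ∑[ j < half ] triangle x (x + m) (half + j)
      ≡⟨ sym (∑-halves (triangle x (x + m))) ⟩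
    ∑[ c < n ] triangle x (x + m) c ∎
    where open ≤-Reasoning

  τ-first-side : ∀ {a} → a < half → m ≤ τ a
  τ-first-side {a} a<half = begin
    m
      ≤⟨ second-side-count a<half ⟩
    ∑[ i < half ] ∑[ c < n ] triangle a (half + i) c
      ≤⟨ m≤n+m _ _ ⟩
    ∑ half (λ b → ∑[ c < n ] triangle a b c) + ∑[ i < half ] ∑[ c < n ] triangle a (half + i) c
      ≡⟨ sym (∑-halves _) ⟩
    τ a ∎
    where open ≤-Reasoning

  -- For a < m both kinds of triangles occur.
  τ-first-quarter : ∀ {a} → a < m → half + m ≤ τ a
  τ-first-quarter {a} a<m = begin
    half + m
      ≤⟨ +-mono-≤ first second ⟩
    ∑ half (λ b → ∑[ c < n ] triangle a b c) + ∑[ i < half ] ∑[ c < n ] triangle a (half + i) c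
      ≡⟨ sym (∑-halves _) ⟩
    τ a ∎
    where
    open ≤-Reasoning
    first : half ≤ ∑ half (λ b → ∑[ c < n ] triangle a b c)
    first = ≤-trans (first-side-count a<m)
                    (∑-term (λ b → ∑[ c < n ] triangle a b c) (+-monoˡ-< m a<m))
    second : m ≤ ∑[ i < half ] ∑[ c < n ] triangle a (half + i) c
    second = second-side-count (<-≤-trans a<m (m≤m+n m m))

  -- Summing over the first side: m (2m + m) + m · m triangles.
  triangle-bound : m * (half + m) + m * m ≤ ∑ n τ
  triangle-bound = begin
    m * (half + m) + m * m
      ≤⟨ +-mono-≤ (∑-lower m _ τ (λ a → τ-first-quarter))
                  (∑-lower m m (λ a → τ (m + a)) (λ a a<m → τ-first-side (+-monoʳ-< m a<m))) ⟩
    ∑ m τ + ∑[ a < m ] τ (m + a)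
      ≡⟨ sym (∑-split m m τ) ⟩
    ∑ half τ
      ≤⟨ m≤m+n _ _ ⟩
    ∑ half τ + ∑[ a < half ] τ (half + a)
      ≡⟨ sym (∑-halves τ) ⟩
    ∑ n τ ∎
    where open ≤-Reasoning

  quarter-square : n * n / 4 ≡ m * (half + m) + m * m
  quarter-square = trans (cong (_/ 4) (identity m)) (m*n/n≡m (m * (half + m) + m * m) 4)
    where
    identity : ∀ m → m * 4 * (m * 4) ≡ (m * ((m + m) + m) + m * m) * 4
    identity = solve-∀

  G-triangles : n * n / 4 ≤ triangleCount G
  G-triangles = begin
    n * n / 4                ≡⟨ quarter-square ⟩
    m * (half + m) + m * m   ≤⟨ triangle-bound ⟩
    ∑ n τ                    ≡⟨ sym (triangleCount-induced n edge edge-sym edge-irrefl) ⟩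
    triangleCount G          ∎
    where open ≤-Reasoning

proposition3p1 : (n : ℕ) → 0 < n → 4 ∣ n → ExK3AtLeast n K122 (n * n / 4)
proposition3p1 .(zero * 4)  ()  (divides zero refl)
proposition3p1 .(suc k * 4) _   (divides (suc k) refl) = G , G-K122-free , G-triangles
  where open Construction (suc k) (s≤s z≤n)
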